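{- Let $\gamma$ be a scoring matrix for an alphabet $\Sigma$ such that $d^{N}_\gamma$ is a premetric on $\Sigma^*$. Let $\mathcal{Q}=\max_{a\in\Sigma}\max\{\gamma(a,-),\gamma(-,a)\}$, suppose $\mathcal{Q}\neq0$, and let $q\in\Sigma$ be a symbol with $\mathcal{Q}=\max\{\gamma(q,-),\gamma(-,q)\}$. Suppose that either $\gamma(q,-)=\gamma(-,q)$, or for each $a,b\in\Sigma$ both $\gamma(a,-)\le\gamma(a,q)+\gamma(q,-)$ and $\gamma(-,b)\le\gamma(-,q)+\gamma(q,b)$ hold. Then for each $a,b\in\Sigma$ there is $n_0$ such that for every integer $n\ge n_0$, $$d^{N}_\gamma(q^n a,\ q^n b)=\min\left\{\frac{\gamma(a,b)}{n+1},\ \frac{\gamma(a,-)+\gamma(-,b)}{n+2}\right\},$$ these two values being the normalized scores of the alignments $[q^n a,\ q^n b]$ and $[q^n a\,-,\ q^n\,-\,b]$ respectively.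
   Context: An alphabet $\Sigma$ is a finite nonempty set of symbols; $-$ denotes a gap symbol not in $\Sigma$, and $\Sigma_-=\Sigma\cup\{ -\}$. $\Sigma^*$ is the set of finite sequences over $\Sigma$, and $q^n$ denotes the sequence consisting of $n$ copies of $q$. A scoring matrix $\gamma$ for $\Sigma$ assigns a real number $\gamma(x,y)$ to every pair $(x,y)\in\Sigma_-\times\Sigma_-$ with $(x,y)\neq(-,-)$. An alignment of $s,t\in\Sigma^*$ is a pair $[s',t']$ of sequences over $\Sigma_-$ of equal length obtained by inserting gap symbols into $s$ and into $t$, with no position $j$ having $s'(j)=t'(j)=-$. Its normalized score is $\big(\sum_j\gamma(s'(j),t'(j))\big)/|s'|$, defined as $0$ when $s=t$ is empty; $d^{N}_\gamma(s,t)$ is the minimum normalized score over all alignments of $s,t$. A function $f:S\times S\to\mathbb{R}$ is a premetric if $f(x,x)=0$ and $f(x,y)\ge0$ for all $x,y\in S$. -}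

module Defs where

open import Level using (0ℓ)
open import Data.Nat as ℕ using (ℕ; zero; suc)
open import Data.Fin using (Fin)
open import Data.Maybe using (Maybe; just; nothing)
open import Data.List using (List; []; _∷_; length; replicate; _++_; [_])
open import Data.Product using (∃; _×_; _,_)
open import Relation.Nullary using (¬_; yes; no)
open import Relation.Binary.PropositionalEquality using (_≡_; _≢_)
open import Relation.Binary.Definitions using (Decidable)
open import Algebra.Structures using (IsCommutativeRing)
open import Relation.Binary.Structures using (IsTotalOrder)

-- We work over an
-- arbitrary Archimedean linearly ordered field (ℝ is an instance; every
-- such field embeds into ℝ).  Inverse is total with the convention
-- 0 ⁻¹ = 0 (harmless: only used on nonzero lengths).

natIter : {A : Set} → A → (A → A) → ℕ → A
natIter z f zero    = z
natIter z f (suc n) = f (natIter z f n)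

record OrderedField : Set₁ where
  infixl 6 _+_
  infixl 7 _*_
  infix  4 _≤_
  field
    Carrier : Set
    _+_ _*_ : Carrier → Carrier → Carrier
    -_      : Carrier → Carrier
    0# 1#   : Carrier
    _⁻¹     : Carrier → Carrier
    _≤_     : Carrier → Carrier → Set
    isCommutativeRing : IsCommutativeRing _≡_ _+_ _*_ -_ 0# 1#
    0≢1       : 0# ≢ 1#
    ⁻¹-inverse : ∀ x → x ≢ 0# → x * (x ⁻¹) ≡ 1#
    ⁻¹-zero    : 0# ⁻¹ ≡ 0#
    isTotalOrder : IsTotalOrder _≡_ _≤_
    _≤?_    : Decidable _≤_
    +-mono-≤ : ∀ {x y} z → x ≤ y → x + z ≤ y + z
    *-nonneg : ∀ {x y} → 0# ≤ x → 0# ≤ y → 0# ≤ x * y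

    archimedean : ∀ x → ∃ λ (n : ℕ) → x ≤ natIter 0# (1# +_) n

  fromℕ : ℕ → Carrier
  fromℕ = natIter 0# (1# +_)

  min max : Carrier → Carrier → Carrier
  min x y with x ≤? y
  ... | yes _ = x
  ... | no  _ = y
  max x y with x ≤? y
  ... | yes _ = y
  ... | no  _ = x

-- Sequence alignment over an alphabet Σ = Fin (suc m) (finite, nonempty).
-- Σ₋ = Maybe Σ, with nothing playing the role of the gap symbol '-'.

module Alignment (𝔽 : OrderedField) (m : ℕ) where
  open OrderedField 𝔽

  Σ : Set
  Σ = Fin (suc m)

  Σ₋ : Set
  Σ₋ = Maybe Σ

  gap : Σ₋
  gap = nothing

  -- A scoring matrix: its value at (-,-) is irrelevant and never used.
  ScoringMatrix : Set
  ScoringMatrix = Σ₋ → Σ₋ → Carrier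

  data Column : Set where
    col : (x y : Σ₋) → ¬ (x ≡ nothing × y ≡ nothing) → Column

  eraseGaps : List Σ₋ → List Σ
  eraseGaps []             = []
  eraseGaps (nothing ∷ xs) = eraseGaps xs
  eraseGaps (just a ∷ xs)  = a ∷ eraseGaps xs

  top bottom : List Column → List Σ₋
  top []               = []
  top (col x _ _ ∷ cs) = x ∷ top cs
  bottom []               = []
  bottom (col _ y _ ∷ cs) = y ∷ bottom cs

  record Alignment (s t : List Σ) : Set where
    constructor alignment
    field
      columns  : List Column
      top-ok    : eraseGaps (top columns) ≡ s
      bottom-ok : eraseGaps (bottom columns) ≡ t

  score : ScoringMatrix → List Column → Carrier
  score γ []               = 0#
  score γ (col x y _ ∷ cs) = γ x y + score γ cs

  normScore : ScoringMatrix → List Column → Carrier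
  normScore γ [] = 0#
  normScore γ cs = score γ cs * (fromℕ (length cs)) ⁻¹

  IsDN : ScoringMatrix → List Σ → List Σ → Carrier → Set
  IsDN γ s t d =
    (∃ λ (A : Alignment s t) → normScore γ (Alignment.columns A) ≡ d)
    × (∀ (A : Alignment s t) → d ≤ normScore γ (Alignment.columns A))

  DNPremetric : ScoringMatrix → Set
  DNPremetric γ =
    (∀ s d → IsDN γ s s d → d ≡ 0#)
    × (∀ s t d → IsDN γ s t d → 0# ≤ d)

  gapMax : ScoringMatrix → Σ → Carrier
  gapMax γ a = max (γ (just a) gap) (γ gap (just a))

{-# OPTIONS --safe #-}
module Submission where

open import Defs
open import Data.Nat as ℕ using (ℕ; zero; suc; z≤n; s≤s)
import Data.Nat.Properties as ℕ
open import Data.List using (List; []; _∷_; length; replicate; _++_; [_])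
open import Data.List.Properties using (∷-injective; length-++; length-replicate)
open import Data.Maybe using (just; nothing)
open import Data.Product using (∃; _×_; _,_; proj₁; proj₂)
open import Data.Sum using (_⊎_; inj₁; inj₂; [_,_]′)
open import Function using (id)
import Data.Nat
open import Data.Empty using (⊥-elim)
open import Relation.Nullary using (¬_; yes; no)
open import Relation.Binary.PropositionalEquality using (_≡_; _≢_; refl; sym; trans; cong; cong₂; subst; subst₂)
open import Relation.Binary.Bundles using (Poset)
open import Relation.Binary.Structures using (IsTotalOrder)
open import Algebra.Bundles using (CommutativeRing)
import Algebra.Solver.Ring.NaturalCoefficients.Default as NaturalCoefficientsSolver
import Relation.Binary.Reasoning.PartialOrder as PartialOrderReasoning
import Algebra.Properties.Ring as RingProperties

-- Write u = γ(q,-) and v = γ(-,q).  Applied to words of length at most one, the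
-- premetric property makes all costs nonnegative and forces γ(q,q) = 0, and
-- u + v > 0 since 𝒬 ≠ 0; when u = v every gap costs at most 𝒬 = u, which gives
-- the two triangle inequalities through q.
--
-- An alignment of qⁿa with qⁿb has k gaps in each row and length n + 1 + k.
-- Charging u or v per gap, nothing per (q,q) column, and the columns of a and b
-- either γ(a,b), when they are matched to each other, or else
-- γ(a,-) + γ(-,b) - u - v (the triangle inequalities cover a column (a,q) or
-- (q,b)), its score is at least γ(a,b) + k(u + v), or at least
-- γ(a,-) + γ(-,b) + (k - 1)(u + v) with k ≥ 1.  By the Archimedean property,
-- for large n both γ(a,b)/(n + 1) and (γ(a,-) + γ(-,b))/(n + 2) lie below
-- u + v, and then by the mediant inequality such extra gaps can only raise the
-- normalized score.

module OrderedFieldProperties (𝔽 : OrderedField) where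
  open OrderedField 𝔽

  commutativeRing : CommutativeRing _ _
  commutativeRing = record { isCommutativeRing = isCommutativeRing }

  open CommutativeRing commutativeRing public
    using (+-assoc; +-comm; +-identityˡ; +-identityʳ; -‿inverseˡ; -‿inverseʳ;
           *-assoc; *-comm; *-identityˡ; *-identityʳ; distribˡ; zeroˡ; zeroʳ)
  open NaturalCoefficientsSolver (CommutativeRing.commutativeSemiring commutativeRing) public
    using (solve; _:=_; _:+_; _:*_; con)
  open IsTotalOrder isTotalOrder public
    using (total; antisym) renaming (refl to ≤-refl; trans to ≤-trans; reflexive to ≤-reflexive)

  open RingProperties (CommutativeRing.ring commutativeRing) using (-‿distribˡ-*; -‿involutive)

  poset : Poset _ _ _
  poset = record { isPartialOrder = IsTotalOrder.isPartialOrder isTotalOrder }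

  open PartialOrderReasoning poset public

  Positive : Carrier → Set
  Positive x = 0# ≤ x × x ≢ 0#

  +-monoʳ-≤ : ∀ z {x y} → x ≤ y → z + x ≤ z + y
  +-monoʳ-≤ z {x} {y} x≤y = begin
    z + x ≡⟨ +-comm z x ⟩
    x + z ≤⟨ +-mono-≤ z x≤y ⟩
    y + z ≡⟨ +-comm y z ⟩
    z + y ∎

  +-cancelʳ-≤ : ∀ z {x y} → x + z ≤ y + z → x ≤ y
  +-cancelʳ-≤ z {x} {y} x+z≤y+z = begin
    x             ≡⟨ sym (cancel x) ⟩
    x + z + - z   ≤⟨ +-mono-≤ (- z) x+z≤y+z ⟩
    y + z + - z   ≡⟨ cancel y ⟩
    y             ∎
    where
    cancel : ∀ w → w + z + - z ≡ w
    cancel w = trans (+-assoc w z (- z)) (trans (cong (w +_) (-‿inverseʳ z)) (+-identityʳ w))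

  x≤x+y : ∀ x {y} → 0# ≤ y → x ≤ x + y
  x≤x+y x {y} 0≤y = begin
    x      ≡⟨ sym (+-identityʳ x) ⟩
    x + 0# ≤⟨ +-monoʳ-≤ x 0≤y ⟩
    x + y  ∎

  x≤y+x : ∀ x {y} → 0# ≤ y → x ≤ y + x
  x≤y+x x {y} 0≤y = subst (x ≤_) (+-comm x y) (x≤x+y x 0≤y)

  +-nonneg : ∀ {x y} → 0# ≤ x → 0# ≤ y → 0# ≤ x + y
  +-nonneg {x} 0≤x 0≤y = ≤-trans 0≤x (x≤x+y x 0≤y)

  *-monoʳ-≤-nonNeg : ∀ {c x y} → 0# ≤ c → x ≤ y → c * x ≤ c * y
  *-monoʳ-≤-nonNeg {c} {x} {y} 0≤c x≤y = begin
    c * x                    ≡⟨ sym (+-identityˡ (c * x)) ⟩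
    0# + c * x               ≤⟨ +-mono-≤ (c * x) (*-nonneg 0≤c 0≤y-x) ⟩
    c * (y + - x) + c * x    ≡⟨ sym (distribˡ c (y + - x) x) ⟩
    c * (y + - x + x)        ≡⟨ cong (c *_) (trans (+-assoc y (- x) x)
                                  (trans (cong (y +_) (-‿inverseˡ x)) (+-identityʳ y))) ⟩
    c * y                    ∎
    where
    0≤y-x : 0# ≤ y + - x
    0≤y-x = subst (_≤ y + - x) (-‿inverseʳ x) (+-mono-≤ (- x) x≤y)

  *-monoˡ-≤-nonNeg : ∀ {c x y} → 0# ≤ c → x ≤ y → x * c ≤ y * c
  *-monoˡ-≤-nonNeg {c} {x} {y} 0≤c x≤y =
    subst₂ _≤_ (*-comm c x) (*-comm c y) (*-monoʳ-≤-nonNeg 0≤c x≤y)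

  0≤1 : 0# ≤ 1#
  0≤1 with total 0# 1#
  ... | inj₁ 0≤1 = 0≤1
  ... | inj₂ 1≤0 = subst (0# ≤_) -1*-1≡1 (*-nonneg 0≤-1 0≤-1)
    where
    0≤-1 : 0# ≤ - 1#
    0≤-1 = subst₂ _≤_ (-‿inverseʳ 1#) (+-identityˡ (- 1#)) (+-mono-≤ (- 1#) 1≤0)
    -1*-1≡1 : (- 1#) * (- 1#) ≡ 1#
    -1*-1≡1 = trans (sym (-‿distribˡ-* 1# (- 1#))) (trans (cong -_ (*-identityˡ (- 1#))) (-‿involutive 1#))

  1≰0 : ¬ (1# ≤ 0#)
  1≰0 1≤0 = 0≢1 (antisym 0≤1 1≤0)

  fromℕ-nonneg : ∀ n → 0# ≤ fromℕ n
  fromℕ-nonneg zero    = ≤-refl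
  fromℕ-nonneg (suc n) = +-nonneg 0≤1 (fromℕ-nonneg n)

  fromℕ-positive : ∀ n → Positive (fromℕ (suc n))
  fromℕ-positive n = fromℕ-nonneg (suc n) , λ 1+n≡0 →
    1≰0 (subst₂ _≤_ (+-identityʳ 1#) 1+n≡0 (+-monoʳ-≤ 1# (fromℕ-nonneg n)))

  fromℕ-mono : ∀ {m n} → m ℕ.≤ n → fromℕ m ≤ fromℕ n
  fromℕ-mono {n = n} z≤n = fromℕ-nonneg n
  fromℕ-mono (s≤s m≤n)    = +-monoʳ-≤ 1# (fromℕ-mono m≤n)

  fromℕ-+ : ∀ m n → fromℕ (m ℕ.+ n) ≡ fromℕ m + fromℕ n
  fromℕ-+ zero    n = sym (+-identityˡ (fromℕ n))
  fromℕ-+ (suc m) n = trans (cong (1# +_) (fromℕ-+ m n)) (sym (+-assoc 1# (fromℕ m) (fromℕ n)))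

  *-*⁻¹-cancel : ∀ {c} x → c ≢ 0# → x * c * c ⁻¹ ≡ x
  *-*⁻¹-cancel {c} x c≢0 =
    trans (*-assoc x c (c ⁻¹)) (trans (cong (x *_) (⁻¹-inverse c c≢0)) (*-identityʳ x))

  *⁻¹-*-cancel : ∀ {c} x → c ≢ 0# → x * c ⁻¹ * c ≡ x
  *⁻¹-*-cancel {c} x c≢0 =
    trans (solve 3 (λ x c c⁻¹ → x :* c⁻¹ :* c := x :* c :* c⁻¹) refl x c (c ⁻¹)) (*-*⁻¹-cancel x c≢0)

  x*c⁻¹≡0⇒x≡0 : ∀ {c x} → c ≢ 0# → x * c ⁻¹ ≡ 0# → x ≡ 0#
  x*c⁻¹≡0⇒x≡0 {c} {x} c≢0 x*c⁻¹≡0 =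
    trans (sym (*⁻¹-*-cancel x c≢0)) (trans (cong (_* c) x*c⁻¹≡0) (zeroˡ c))

  ⁻¹-nonneg : ∀ {c} → Positive c → 0# ≤ c ⁻¹
  ⁻¹-nonneg {c} (0≤c , c≢0) with total 0# (c ⁻¹)
  ... | inj₁ 0≤c⁻¹ = 0≤c⁻¹
  ... | inj₂ c⁻¹≤0 = ⊥-elim (1≰0 (subst₂ _≤_ (⁻¹-inverse c c≢0) (zeroʳ c) (*-monoʳ-≤-nonNeg 0≤c c⁻¹≤0)))

  *⁻¹-≤-*⁻¹ : ∀ {c d x y} → Positive c → Positive d → x * d ≤ y * c → x * c ⁻¹ ≤ y * d ⁻¹
  *⁻¹-≤-*⁻¹ {c} {d} {x} {y} c>0 d>0 xd≤yc = begin
    x * c ⁻¹                  ≡⟨ sym (*-*⁻¹-cancel (x * c ⁻¹) (proj₂ d>0)) ⟩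
    x * c ⁻¹ * d * d ⁻¹       ≡⟨ swap x (c ⁻¹) d (d ⁻¹) ⟩
    x * d * (c ⁻¹ * d ⁻¹)     ≤⟨ *-monoˡ-≤-nonNeg (*-nonneg (⁻¹-nonneg c>0) (⁻¹-nonneg d>0)) xd≤yc ⟩
    y * c * (c ⁻¹ * d ⁻¹)     ≡⟨ swap′ y c (c ⁻¹) (d ⁻¹) ⟩
    y * d ⁻¹ * c * c ⁻¹       ≡⟨ *-*⁻¹-cancel (y * d ⁻¹) (proj₂ c>0) ⟩
    y * d ⁻¹                  ∎
    where
    swap : ∀ x c⁻¹ d d⁻¹ → x * c⁻¹ * d * d⁻¹ ≡ x * d * (c⁻¹ * d⁻¹)
    swap = solve 4 (λ x c⁻¹ d d⁻¹ → x :* c⁻¹ :* d :* d⁻¹ := x :* d :* (c⁻¹ :* d⁻¹)) refl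
    swap′ : ∀ y c c⁻¹ d⁻¹ → y * c * (c⁻¹ * d⁻¹) ≡ y * d⁻¹ * c * c⁻¹
    swap′ = solve 4 (λ y c c⁻¹ d⁻¹ → y :* c :* (c⁻¹ :* d⁻¹) := y :* d⁻¹ :* c :* c⁻¹) refl

  -- the mediant inequality: x / L ≤ g implies x / L ≤ (x + k g) / (L + k)
  ratio-≤-padded-ratio : ∀ l k {g x s} → x ≤ g * fromℕ (suc l) → x + fromℕ k * g ≤ s →
                         x * fromℕ (suc l) ⁻¹ ≤ s * fromℕ (suc l ℕ.+ k) ⁻¹
  ratio-≤-padded-ratio l k {g} {x} {s} x≤gL x+Kg≤s =
    *⁻¹-≤-*⁻¹ (fromℕ-positive l) (fromℕ-positive (l ℕ.+ k)) (begin
      x * fromℕ (suc l ℕ.+ k)  ≡⟨ cong (x *_) (fromℕ-+ (suc l) k) ⟩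
      x * (L + K)              ≡⟨ distribˡ x L K ⟩
      x * L + x * K            ≤⟨ +-monoʳ-≤ (x * L) (*-monoˡ-≤-nonNeg (fromℕ-nonneg k) x≤gL) ⟩
      x * L + g * L * K        ≡⟨ solve 4 (λ x L K g → x :* L :+ g :* L :* K := (x :+ K :* g) :* L) refl x L K g ⟩
      (x + K * g) * L          ≤⟨ *-monoˡ-≤-nonNeg (fromℕ-nonneg (suc l)) x+Kg≤s ⟩
      s * L                    ∎)
    where
    L K : Carrier
    L = fromℕ (suc l)
    K = fromℕ k

  archimedean-multiple : ∀ {g} → Positive g → ∀ x → ∃ λ n₀ → ∀ n → n₀ ℕ.≤ n → x ≤ g * fromℕ n
  archimedean-multiple {g} g>0 x with archimedean (x * g ⁻¹)
  ... | n₀ , x/g≤n₀ = n₀ , λ n n₀≤n → begin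
    x                ≡⟨ sym (*⁻¹-*-cancel x (proj₂ g>0)) ⟩
    x * g ⁻¹ * g     ≡⟨ *-comm (x * g ⁻¹) g ⟩
    g * (x * g ⁻¹)   ≤⟨ *-monoʳ-≤-nonNeg (proj₁ g>0) (≤-trans x/g≤n₀ (fromℕ-mono n₀≤n)) ⟩
    g * fromℕ n      ∎

  min-≤ˡ : ∀ x y → min x y ≤ x
  min-≤ˡ x y with x ≤? y
  ... | yes _  = ≤-refl
  ... | no x≰y with total x y
  ...   | inj₁ x≤y = ⊥-elim (x≰y x≤y)
  ...   | inj₂ y≤x = y≤x

  min-≤ʳ : ∀ x y → min x y ≤ y
  min-≤ʳ x y with x ≤? y
  ... | yes x≤y = x≤y
  ... | no _    = ≤-refl

  min-sel : ∀ x y → min x y ≡ x ⊎ min x y ≡ y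
  min-sel x y with x ≤? y
  ... | yes _ = inj₁ refl
  ... | no _  = inj₂ refl

  max-≥ˡ : ∀ x y → x ≤ max x y
  max-≥ˡ x y with x ≤? y
  ... | yes x≤y = x≤y
  ... | no _    = ≤-refl

  max-≥ʳ : ∀ x y → y ≤ max x y
  max-≥ʳ x y with x ≤? y
  ... | yes _  = ≤-refl
  ... | no x≰y with total x y
  ...   | inj₁ x≤y = ⊥-elim (x≰y x≤y)
  ...   | inj₂ y≤x = y≤x

  max-sel : ∀ x y → max x y ≡ x ⊎ max x y ≡ y
  max-sel x y with x ≤? y
  ... | yes _ = inj₂ refl
  ... | no _  = inj₁ refl

  max-idem : ∀ x → max x x ≡ x
  max-idem x with x ≤? x
  ... | yes _ = refl
  ... | no _  = refl

  max≢0⇒+-positive : ∀ {x y} → 0# ≤ x → 0# ≤ y → max x y ≢ 0# → Positive (x + y)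
  max≢0⇒+-positive {x} {y} 0≤x 0≤y max≢0 = +-nonneg 0≤x 0≤y , x+y≢0
    where
    x+y≢0 : x + y ≢ 0#
    x+y≢0 x+y≡0 with max-sel x y
    ... | inj₁ max≡x = max≢0 (trans max≡x (antisym (subst (x ≤_) x+y≡0 (x≤x+y x 0≤y)) 0≤x))
    ... | inj₂ max≡y = max≢0 (trans max≡y (antisym (subst (y ≤_) x+y≡0 (x≤y+x y 0≤x)) 0≤y))

module AlignmentProperties (𝔽 : OrderedField) (m : ℕ) where
  open OrderedField 𝔽
  open Alignment 𝔽 m
  open OrderedFieldProperties 𝔽
  open Alignment.Alignment using (columns)

  match : Σ → Σ → Column
  match x y = col (just x) (just y) λ { (() , _) }

  deletion : Σ → Column
  deletion x = col (just x) gap λ { (() , _) }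

  insertion : Σ → Column
  insertion y = col gap (just y) λ { (_ , ()) }

  topGaps bottomGaps : List Column → ℕ
  topGaps []                      = 0
  topGaps (col nothing _ _ ∷ cs)  = suc (topGaps cs)
  topGaps (col (just _) _ _ ∷ cs) = topGaps cs
  bottomGaps []                      = 0
  bottomGaps (col _ nothing _ ∷ cs)  = suc (bottomGaps cs)
  bottomGaps (col _ (just _) _ ∷ cs) = bottomGaps cs

  length≡top+topGaps : ∀ cs → length cs ≡ length (eraseGaps (top cs)) ℕ.+ topGaps cs
  length≡top+topGaps []                      = refl
  length≡top+topGaps (col nothing _ _ ∷ cs)  =
    trans (cong suc (length≡top+topGaps cs)) (sym (ℕ.+-suc _ (topGaps cs)))
  length≡top+topGaps (col (just _) _ _ ∷ cs) = cong suc (length≡top+topGaps cs)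

  length≡bottom+bottomGaps : ∀ cs → length cs ≡ length (eraseGaps (bottom cs)) ℕ.+ bottomGaps cs
  length≡bottom+bottomGaps []                      = refl
  length≡bottom+bottomGaps (col _ nothing _ ∷ cs)  =
    trans (cong suc (length≡bottom+bottomGaps cs)) (sym (ℕ.+-suc _ (bottomGaps cs)))
  length≡bottom+bottomGaps (col _ (just _) _ ∷ cs) = cong suc (length≡bottom+bottomGaps cs)

  length-replicate-++-[_] : ∀ {A : Set} {x : A} y n → length (replicate n x ++ [ y ]) ≡ suc n
  length-replicate-++-[ y ] zero    = refl
  length-replicate-++-[ y ] (suc n) = cong suc (length-replicate-++-[ y ] n)

  both-empty⇒[] : ∀ cs → eraseGaps (top cs) ≡ [] → eraseGaps (bottom cs) ≡ [] → cs ≡ []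
  both-empty⇒[] []                            _  _  = refl
  both-empty⇒[] (col nothing nothing p ∷ _)   _  _  = ⊥-elim (p (refl , refl))
  both-empty⇒[] (col (just _) _ _ ∷ _)        () _
  both-empty⇒[] (col nothing (just _) _ ∷ _)  _  ()

  lone-deletion : ∀ {x} cs → eraseGaps (top cs) ≡ [ x ] → eraseGaps (bottom cs) ≡ [] →
                  ∃ λ p → cs ≡ [ col (just x) gap p ]
  lone-deletion []                           ()  _
  lone-deletion (col nothing nothing p ∷ _)  _   _  = ⊥-elim (p (refl , refl))
  lone-deletion (col nothing (just _) _ ∷ _) _   ()
  lone-deletion (col (just _) nothing p ∷ cs) ht hb with ∷-injective ht
  ... | refl , ht′ rewrite both-empty⇒[] cs ht′ hb = p , refl

  lone-insertion : ∀ {y} cs → eraseGaps (top cs) ≡ [] → eraseGaps (bottom cs) ≡ [ y ] →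
                   ∃ λ p → cs ≡ [ col gap (just y) p ]
  lone-insertion []                           _  ()
  lone-insertion (col nothing nothing p ∷ _)  _  _  = ⊥-elim (p (refl , refl))
  lone-insertion (col (just _) _ _ ∷ _)       () _
  lone-insertion (col nothing (just _) p ∷ cs) ht hb with ∷-injective hb
  ... | refl , hb′ rewrite both-empty⇒[] cs ht hb′ = p , refl

  matched separated : ∀ x y → Alignment [ x ] [ y ]
  matched x y   = alignment [ match x y ] refl refl
  separated x y = alignment (deletion x ∷ insertion y ∷ []) refl refl

  top-padded : ∀ {x} n cs → eraseGaps (top (replicate n (match x x) ++ cs)) ≡ replicate n x ++ eraseGaps (top cs)
  top-padded zero    cs = refl
  top-padded (suc n) cs = cong (_ ∷_) (top-padded n cs)

  bottom-padded : ∀ {x} n cs → eraseGaps (bottom (replicate n (match x x) ++ cs)) ≡ replicate n x ++ eraseGaps (bottom cs)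
  bottom-padded zero    cs = refl
  bottom-padded (suc n) cs = cong (_ ∷_) (bottom-padded n cs)

  pad : ∀ {s t} x n → Alignment s t → Alignment (replicate n x ++ s) (replicate n x ++ t)
  pad x n (alignment cs top-ok bottom-ok) = alignment (replicate n (match x x) ++ cs)
    (trans (top-padded n cs) (cong (replicate n x ++_) top-ok))
    (trans (bottom-padded n cs) (cong (replicate n x ++_) bottom-ok))

  module _ (γ : ScoringMatrix) where

    -- also holds for the empty alignment, because 0 ⁻¹ = 0
    normScore≡score*length⁻¹ : ∀ cs → normScore γ cs ≡ score γ cs * fromℕ (length cs) ⁻¹
    normScore≡score*length⁻¹ []      = sym (zeroˡ (0# ⁻¹))
    normScore≡score*length⁻¹ (_ ∷ _) = refl

    columnScore : Column → Carrier
    columnScore (col x y _) = γ x y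

    normScore-[_] : ∀ c → normScore γ [ c ] ≡ columnScore c
    normScore-[ col x y _ ] = begin-equality
      (γ x y + 0#) * (1# + 0#) ⁻¹   ≡⟨ cong₂ (λ a b → a * b ⁻¹) (+-identityʳ (γ x y)) (+-identityʳ 1#) ⟩
      γ x y * 1# ⁻¹                 ≡⟨ cong (γ x y *_) 1⁻¹≡1 ⟩
      γ x y * 1#                    ≡⟨ *-identityʳ (γ x y) ⟩
      γ x y                         ∎
      where
      1⁻¹≡1 : 1# ⁻¹ ≡ 1#
      1⁻¹≡1 = trans (sym (*-identityˡ (1# ⁻¹))) (⁻¹-inverse 1# (λ 1≡0 → 0≢1 (sym 1≡0)))

    score-padded : ∀ {x} → γ (just x) (just x) ≡ 0# → ∀ n cs → score γ (replicate n (match x x) ++ cs) ≡ score γ cs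
    score-padded γxx≡0 zero    cs = refl
    score-padded γxx≡0 (suc n) cs =
      trans (cong₂ _+_ γxx≡0 (score-padded γxx≡0 n cs)) (+-identityˡ (score γ cs))

    normScore-pad : ∀ {x s t} → γ (just x) (just x) ≡ 0# → ∀ n (A : Alignment s t) →
                    normScore γ (columns (pad x n A)) ≡ score γ (columns A) * fromℕ (n ℕ.+ length (columns A)) ⁻¹
    normScore-pad {x} γxx≡0 n (alignment cs _ _) = begin-equality
      normScore γ (replicate n (match x x) ++ cs)
        ≡⟨ normScore≡score*length⁻¹ (replicate n (match x x) ++ cs) ⟩
      score γ (replicate n (match x x) ++ cs) * fromℕ (length (replicate n (match x x) ++ cs)) ⁻¹
        ≡⟨ cong₂ (λ s l → s * fromℕ l ⁻¹) (score-padded γxx≡0 n cs)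
                 (trans (length-++ (replicate n (match x x))) (cong (ℕ._+ length cs) (length-replicate n))) ⟩
      score γ cs * fromℕ (n ℕ.+ length cs) ⁻¹ ∎

    isDN-min : ∀ {s t d₁ d₂} (A₁ A₂ : Alignment s t) →
               normScore γ (columns A₁) ≡ d₁ → normScore γ (columns A₂) ≡ d₂ →
               (∀ A → min d₁ d₂ ≤ normScore γ (columns A)) → IsDN γ s t (min d₁ d₂)
    isDN-min {d₁ = d₁} {d₂} A₁ A₂ A₁≡d₁ A₂≡d₂ lower = attained (min-sel d₁ d₂) , lower
      where
      attained : min d₁ d₂ ≡ d₁ ⊎ min d₁ d₂ ≡ d₂ → ∃ λ A → normScore γ (columns A) ≡ min d₁ d₂
      attained (inj₁ min≡d₁) = A₁ , trans A₁≡d₁ (sym min≡d₁)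
      attained (inj₂ min≡d₂) = A₂ , trans A₂≡d₂ (sym min≡d₂)

    isDN-[x][] : ∀ x → IsDN γ [ x ] [] (γ (just x) gap)
    isDN-[x][] x = (alignment [ deletion x ] refl refl , normScore-[ deletion x ]) , lower
      where
      lower : ∀ A → γ (just x) gap ≤ normScore γ (columns A)
      lower (alignment cs top-ok bottom-ok) with lone-deletion cs top-ok bottom-ok
      ... | p , refl = ≤-reflexive (sym normScore-[ col (just x) gap p ])

    isDN-[][y] : ∀ y → IsDN γ [] [ y ] (γ gap (just y))
    isDN-[][y] y = (alignment [ insertion y ] refl refl , normScore-[ insertion y ]) , lower
      where
      lower : ∀ A → γ gap (just y) ≤ normScore γ (columns A)
      lower (alignment cs top-ok bottom-ok) with lone-insertion cs top-ok bottom-ok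
      ... | p , refl = ≤-reflexive (sym normScore-[ col gap (just y) p ])

    isDN-[x][y] : ∀ x y → IsDN γ [ x ] [ y ]
                    (min (γ (just x) (just y)) ((γ (just x) gap + γ gap (just y)) * fromℕ 2 ⁻¹))
    isDN-[x][y] x y = isDN-min (matched x y) (separated x y) normScore-[ match x y ] separated≡ lower
      where
      d : Carrier
      d = min (γ (just x) (just y)) ((γ (just x) gap + γ gap (just y)) * fromℕ 2 ⁻¹)
      separated≡ : (γ (just x) gap + (γ gap (just y) + 0#)) * fromℕ 2 ⁻¹
                 ≡ (γ (just x) gap + γ gap (just y)) * fromℕ 2 ⁻¹
      separated≡ = cong (λ s → (γ (just x) gap + s) * fromℕ 2 ⁻¹) (+-identityʳ (γ gap (just y)))
      reversed≡ : (γ gap (just y) + (γ (just x) gap + 0#)) * fromℕ 2 ⁻¹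
                ≡ (γ (just x) gap + γ gap (just y)) * fromℕ 2 ⁻¹
      reversed≡ = cong (_* fromℕ 2 ⁻¹)
        (solve 2 (λ g h → h :+ (g :+ con 0) := g :+ h) refl (γ (just x) gap) (γ gap (just y)))
      lower : ∀ A → d ≤ normScore γ (columns A)
      lower (alignment cs top-ok bottom-ok) = lower′ cs top-ok bottom-ok
        where
        lower′ : ∀ cs → eraseGaps (top cs) ≡ [ x ] → eraseGaps (bottom cs) ≡ [ y ] → d ≤ normScore γ cs
        lower′ []                          ()  _
        lower′ (col nothing nothing p ∷ _) _   _  = ⊥-elim (p (refl , refl))
        lower′ (col (just _) (just _) p ∷ cs) ht hb with ∷-injective ht | ∷-injective hb
        ... | refl , ht′ | refl , hb′ rewrite both-empty⇒[] cs ht′ hb′ =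
          ≤-trans (min-≤ˡ _ _) (≤-reflexive (sym normScore-[ col (just x) (just y) p ]))
        lower′ (col (just _) nothing _ ∷ cs) ht hb with ∷-injective ht
        ... | refl , ht′ with lone-insertion cs ht′ hb
        ...   | _ , refl = ≤-trans (min-≤ʳ _ _) (≤-reflexive (sym separated≡))
        lower′ (col nothing (just _) _ ∷ cs) ht hb with ∷-injective hb
        ... | refl , hb′ with lone-deletion cs ht hb′
        ...   | _ , refl = ≤-trans (min-≤ʳ _ _) (≤-reflexive (sym reversed≡))

    insertions-only : ∀ {z y} j cs → eraseGaps (top cs) ≡ [] → eraseGaps (bottom cs) ≡ replicate j z ++ [ y ] →
                      topGaps cs ≡ suc j × bottomGaps cs ≡ 0 × score γ cs ≡ fromℕ j * γ gap (just z) + γ gap (just y)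
    insertions-only j       (col nothing nothing p ∷ _) _  _  = ⊥-elim (p (refl , refl))
    insertions-only j       (col (just _) _ _ ∷ _)      () _
    insertions-only zero    []                          _  ()
    insertions-only (suc j) []                          _  ()
    insertions-only {z} {y} zero (col nothing (just _) _ ∷ cs) ht hb with ∷-injective hb
    ... | refl , hb′ rewrite both-empty⇒[] cs ht hb′ =
      refl , refl , solve 2 (λ g h → h :+ con 0 := con 0 :* g :+ h) refl (γ gap (just z)) (γ gap (just y))
    insertions-only {z} {y} (suc j) (col nothing (just _) _ ∷ cs) ht hb with ∷-injective hb
    ... | refl , hb′ with insertions-only j cs ht hb′
    ...   | gaps≡ , noGaps , score≡ = cong suc gaps≡ , noGaps ,
      trans (cong (γ gap (just z) +_) score≡)
        (solve 3 (λ g h J → g :+ (J :* g :+ h) := (con 1 :+ J) :* g :+ h) refl (γ gap (just z)) (γ gap (just y)) (fromℕ j))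

    deletions-only : ∀ {z x} i cs → eraseGaps (top cs) ≡ replicate i z ++ [ x ] → eraseGaps (bottom cs) ≡ [] →
                     topGaps cs ≡ 0 × bottomGaps cs ≡ suc i × score γ cs ≡ fromℕ i * γ (just z) gap + γ (just x) gap
    deletions-only i       (col nothing nothing p ∷ _) _  _  = ⊥-elim (p (refl , refl))
    deletions-only i       (col _ (just _) _ ∷ _)      _  ()
    deletions-only zero    []                          () _
    deletions-only (suc i) []                          () _
    deletions-only {z} {x} zero (col (just _) nothing _ ∷ cs) ht hb with ∷-injective ht
    ... | refl , ht′ rewrite both-empty⇒[] cs ht′ hb =
      refl , refl , solve 2 (λ g h → h :+ con 0 := con 0 :* g :+ h) refl (γ (just z) gap) (γ (just x) gap)
    deletions-only {z} {x} (suc i) (col (just _) nothing _ ∷ cs) ht hb with ∷-injective ht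
    ... | refl , ht′ with deletions-only i cs ht′ hb
    ...   | noGaps , gaps≡ , score≡ = noGaps , cong suc gaps≡ ,
      trans (cong (γ (just z) gap +_) score≡)
        (solve 3 (λ g h I → g :+ (I :* g :+ h) := (con 1 :+ I) :* g :+ h) refl (γ (just z) gap) (γ (just x) gap) (fromℕ i))

module PremetricProperties (𝔽 : OrderedField) (m : ℕ) (γ : Alignment.ScoringMatrix 𝔽 m)
                           (premetric : Alignment.DNPremetric 𝔽 m γ) where
  open OrderedField 𝔽
  open Alignment 𝔽 m
  open OrderedFieldProperties 𝔽
  open AlignmentProperties 𝔽 m

  private
    dN-zero : ∀ s d → IsDN γ s s d → d ≡ 0#
    dN-zero = proj₁ premetric
    dN-nonneg : ∀ s t d → IsDN γ s t d → 0# ≤ d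
    dN-nonneg = proj₂ premetric

  deletion-nonneg : ∀ x → 0# ≤ γ (just x) gap
  deletion-nonneg x = dN-nonneg _ _ _ (isDN-[x][] γ x)

  insertion-nonneg : ∀ y → 0# ≤ γ gap (just y)
  insertion-nonneg y = dN-nonneg _ _ _ (isDN-[][y] γ y)

  match-nonneg : ∀ x y → 0# ≤ γ (just x) (just y)
  match-nonneg x y = ≤-trans (dN-nonneg _ _ _ (isDN-[x][y] γ x y)) (min-≤ˡ _ _)

  self-match≡0 : ∀ x → γ (just x) gap + γ gap (just x) ≢ 0# → γ (just x) (just x) ≡ 0#
  self-match≡0 x gaps≢0 with min-sel (γ (just x) (just x)) ((γ (just x) gap + γ gap (just x)) * fromℕ 2 ⁻¹)
  ... | inj₁ min≡match = trans (sym min≡match) (dN-zero _ _ (isDN-[x][y] γ x x))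
  ... | inj₂ min≡gaps  = ⊥-elim (gaps≢0 (x*c⁻¹≡0⇒x≡0 (proj₂ (fromℕ-positive 1))
                                   (trans (sym min≡gaps) (dN-zero _ _ (isDN-[x][y] γ x x)))))

  balanced-max-gap⇒triangles : ∀ q → (∀ a → gapMax γ a ≤ gapMax γ q) → γ (just q) gap ≡ γ gap (just q) →
    ∀ a b → (γ (just a) gap ≤ γ (just a) (just q) + γ (just q) gap)
          × (γ gap (just b) ≤ γ gap (just q) + γ (just q) (just b))
  balanced-max-gap⇒triangles q q-max u≡v a b = a-triangle , b-triangle
    where
    gapMax-q≡u : gapMax γ q ≡ γ (just q) gap
    gapMax-q≡u = trans (cong (max (γ (just q) gap)) (sym u≡v)) (max-idem (γ (just q) gap))
    a-triangle : γ (just a) gap ≤ γ (just a) (just q) + γ (just q) gap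
    a-triangle = begin
      γ (just a) gap                        ≤⟨ max-≥ˡ _ _ ⟩
      gapMax γ a                            ≤⟨ q-max a ⟩
      gapMax γ q                            ≡⟨ gapMax-q≡u ⟩
      γ (just q) gap                        ≤⟨ x≤y+x (γ (just q) gap) (match-nonneg a q) ⟩
      γ (just a) (just q) + γ (just q) gap  ∎
    b-triangle : γ gap (just b) ≤ γ gap (just q) + γ (just q) (just b)
    b-triangle = begin
      γ gap (just b)                        ≤⟨ max-≥ʳ _ _ ⟩
      gapMax γ b                            ≤⟨ q-max b ⟩
      gapMax γ q                            ≡⟨ trans gapMax-q≡u u≡v ⟩
      γ gap (just q)                        ≤⟨ x≤x+y (γ gap (just q)) (match-nonneg q b) ⟩
      γ gap (just q) + γ (just q) (just b)  ∎

module PaddedWords (𝔽 : OrderedField) (m : ℕ) (γ : Alignment.ScoringMatrix 𝔽 m) (q a b : Alignment.Σ 𝔽 m) where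
  open OrderedField 𝔽
  open Alignment 𝔽 m
  open OrderedFieldProperties 𝔽
  open AlignmentProperties 𝔽 m
  open Alignment.Alignment using (columns)

  u v A B : Carrier
  u = γ (just q) gap
  v = γ gap (just q)
  A = γ (just a) (just b)
  B = γ (just a) gap + γ gap (just b)

  gapCost : ℕ → ℕ → Carrier
  gapCost gt gb = fromℕ gt * v + fromℕ gb * u

  -- When a and b lie in different columns, B pays for one top and one bottom
  -- column in place of v and u; this is the correction u + v.
  data ScoreBound (gt gb : ℕ) (s : Carrier) : Set where
    ab-matched   : A + gapCost gt gb ≤ s → ScoreBound gt gb s
    ab-separated : B + gapCost gt gb ≤ s + (u + v) → 0 ℕ.< gt ℕ.+ gb → ScoreBound gt gb s

  bound-after-match : ∀ {gt gb s c} → 0# ≤ c → ScoreBound gt gb s → ScoreBound gt gb (c + s)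
  bound-after-match {s = s} 0≤c (ab-matched bound)       = ab-matched (≤-trans bound (x≤y+x s 0≤c))
  bound-after-match {s = s} 0≤c (ab-separated bound gaps) =
    ab-separated (≤-trans bound (+-mono-≤ (u + v) (x≤y+x s 0≤c))) gaps

  +gapCost-sucʳ : ∀ x gt gb → x + gapCost gt (suc gb) ≡ u + (x + gapCost gt gb)
  +gapCost-sucʳ x gt gb = solve 5 (λ x G B v u → x :+ (G :* v :+ (con 1 :+ B) :* u) := u :+ (x :+ (G :* v :+ B :* u)))
                            refl x (fromℕ gt) (fromℕ gb) v u

  +gapCost-sucˡ : ∀ x gt gb → x + gapCost (suc gt) gb ≡ v + (x + gapCost gt gb)
  +gapCost-sucˡ x gt gb = solve 5 (λ x G B v u → x :+ ((con 1 :+ G) :* v :+ B :* u) := v :+ (x :+ (G :* v :+ B :* u)))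
                            refl x (fromℕ gt) (fromℕ gb) v u

  bound-after-deletion : ∀ {gt gb s} → ScoreBound gt gb s → ScoreBound gt (suc gb) (u + s)
  bound-after-deletion {gt} {gb} {s} (ab-matched bound)   =
    ab-matched (subst (_≤ u + s) (sym (+gapCost-sucʳ A gt gb)) (+-monoʳ-≤ u bound))
  bound-after-deletion {gt} {gb} {s} (ab-separated bound _) = ab-separated
    (subst₂ _≤_ (sym (+gapCost-sucʳ B gt gb)) (sym (+-assoc u s (u + v))) (+-monoʳ-≤ u bound))
    (ℕ.≤-trans (s≤s z≤n) (ℕ.m≤n+m (suc gb) gt))

  bound-after-insertion : ∀ {gt gb s} → ScoreBound gt gb s → ScoreBound (suc gt) gb (v + s)
  bound-after-insertion {gt} {gb} {s} (ab-matched bound)   =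
    ab-matched (subst (_≤ v + s) (sym (+gapCost-sucˡ A gt gb)) (+-monoʳ-≤ v bound))
  bound-after-insertion {gt} {gb} {s} (ab-separated bound _) = ab-separated
    (subst₂ _≤_ (sym (+gapCost-sucˡ B gt gb)) (sym (+-assoc v s (u + v))) (+-monoʳ-≤ v bound))
    (s≤s z≤n)

  a-matched-b : ScoreBound 0 0 (A + 0#)
  a-matched-b = ab-matched (≤-reflexive (cong (A +_) (solve 2 (λ v u → con 0 :* v :+ con 0 :* u := con 0) refl v u)))

  a-deleted : ∀ j → ScoreBound (suc j) 1 (γ (just a) gap + (fromℕ j * v + γ gap (just b)))
  a-deleted j = ab-separated (≤-reflexive
    (solve 5 (λ ga gb J v u → ga :+ gb :+ ((con 1 :+ J) :* v :+ (con 1 :+ con 0) :* u)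
                              := ga :+ (J :* v :+ gb) :+ (u :+ v))
       refl (γ (just a) gap) (γ gap (just b)) (fromℕ j) v u)) (s≤s z≤n)

  b-inserted : ∀ i → ScoreBound 1 (suc i) (γ gap (just b) + (fromℕ i * u + γ (just a) gap))
  b-inserted i = ab-separated (≤-reflexive
    (solve 5 (λ ga gb I v u → ga :+ gb :+ ((con 1 :+ con 0) :* v :+ (con 1 :+ I) :* u)
                              := gb :+ (I :* u :+ ga) :+ (u :+ v))
       refl (γ (just a) gap) (γ gap (just b)) (fromℕ i) v u)) (s≤s z≤n)

  B+gapCost-suc-diag : ∀ k → B + gapCost (suc k) (suc k) ≡ B + fromℕ k * (u + v) + (u + v)
  B+gapCost-suc-diag k = solve 4 (λ B K v u → B :+ ((con 1 :+ K) :* v :+ (con 1 :+ K) :* u)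
                                             := B :+ K :* (u :+ v) :+ (u :+ v)) refl B (fromℕ k) v u

  gapCost-diag : ∀ k → gapCost k k ≡ fromℕ k * (u + v)
  gapCost-diag k = solve 3 (λ K v u → K :* v :+ K :* u := K :* (u :+ v)) refl (fromℕ k) v u

  ScoreBound⇒min≤ratio : ∀ n → A ≤ (u + v) * fromℕ (suc n) → B ≤ (u + v) * fromℕ (suc (suc n)) →
    ∀ k s → ScoreBound k k s →
    min (A * fromℕ (suc n) ⁻¹) (B * fromℕ (suc (suc n)) ⁻¹) ≤ s * fromℕ (suc n ℕ.+ k) ⁻¹
  ScoreBound⇒min≤ratio n A≤ B≤ k s (ab-matched bound) =
    ≤-trans (min-≤ˡ _ _) (ratio-≤-padded-ratio n k A≤ (subst (λ c → A + c ≤ s) (gapCost-diag k) bound))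
  ScoreBound⇒min≤ratio n A≤ B≤ zero s (ab-separated _ ())
  ScoreBound⇒min≤ratio n A≤ B≤ (suc k) s (ab-separated bound _) =
    ≤-trans (min-≤ʳ _ _) (subst (λ l → B * fromℕ (suc (suc n)) ⁻¹ ≤ s * fromℕ l ⁻¹) (sym (ℕ.+-suc (suc n) k))
      (ratio-≤-padded-ratio (suc n) k B≤
        (+-cancelʳ-≤ (u + v) (subst (_≤ s + (u + v)) (B+gapCost-suc-diag k) bound))))

  module _ (γqq≡0 : γ (just q) (just q) ≡ 0#)
           (a-triangle : γ (just a) gap ≤ γ (just a) (just q) + γ (just q) gap)
           (b-triangle : γ gap (just b) ≤ γ gap (just q) + γ (just q) (just b)) where

    a-mismatched : ∀ j → ScoreBound (suc j) 0 (γ (just a) (just q) + (fromℕ j * v + γ gap (just b)))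
    a-mismatched j = ab-separated (begin
      B + gapCost (suc j) 0                        ≡⟨ solve 5 (λ ga gb J v u → ga :+ gb :+ ((con 1 :+ J) :* v :+ con 0 :* u)
                                                                              := ga :+ (J :* v :+ gb :+ v))
                                                        refl (γ (just a) gap) (γ gap (just b)) (fromℕ j) v u ⟩
      γ (just a) gap + (rest + v)                  ≤⟨ +-mono-≤ (rest + v) a-triangle ⟩
      γ (just a) (just q) + u + (rest + v)         ≡⟨ solve 4 (λ gaq r v u → gaq :+ u :+ (r :+ v) := gaq :+ r :+ (u :+ v))
                                                        refl (γ (just a) (just q)) rest v u ⟩
      γ (just a) (just q) + rest + (u + v)         ∎) (s≤s z≤n)
      where
      rest : Carrier
      rest = fromℕ j * v + γ gap (just b)

    b-mismatched : ∀ i → ScoreBound 0 (suc i) (γ (just q) (just b) + (fromℕ i * u + γ (just a) gap))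
    b-mismatched i = ab-separated (begin
      B + gapCost 0 (suc i)                        ≡⟨ solve 5 (λ ga gb I v u → ga :+ gb :+ (con 0 :* v :+ (con 1 :+ I) :* u)
                                                                              := gb :+ (I :* u :+ ga :+ u))
                                                        refl (γ (just a) gap) (γ gap (just b)) (fromℕ i) v u ⟩
      γ gap (just b) + (rest + u)                  ≤⟨ +-mono-≤ (rest + u) b-triangle ⟩
      v + γ (just q) (just b) + (rest + u)         ≡⟨ solve 4 (λ gqb r v u → v :+ gqb :+ (r :+ u) := gqb :+ r :+ (u :+ v))
                                                        refl (γ (just q) (just b)) rest v u ⟩
      γ (just q) (just b) + rest + (u + v)         ∎) (s≤s z≤n)
      where
      rest : Carrier
      rest = fromℕ i * u + γ (just a) gap

    score-bound : ∀ i j cs →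
                  eraseGaps (top cs) ≡ replicate i q ++ [ a ] → eraseGaps (bottom cs) ≡ replicate j q ++ [ b ] →
                  ScoreBound (topGaps cs) (bottomGaps cs) (score γ cs)
    score-bound zero    _ [] () _
    score-bound (suc _) _ [] () _
    score-bound _ _ (col nothing nothing p ∷ _) _ _ = ⊥-elim (p (refl , refl))
    score-bound (suc i) (suc j) (col (just _) (just _) _ ∷ cs) ht hb with ∷-injective ht | ∷-injective hb
    ... | refl , ht′ | refl , hb′ = bound-after-match (≤-reflexive (sym γqq≡0)) (score-bound i j cs ht′ hb′)
    score-bound zero zero (col (just _) (just _) _ ∷ cs) ht hb with ∷-injective ht | ∷-injective hb
    ... | refl , ht′ | refl , hb′ rewrite both-empty⇒[] cs ht′ hb′ = a-matched-b
    score-bound zero (suc j) (col (just _) (just _) _ ∷ cs) ht hb with ∷-injective ht | ∷-injective hb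
    ... | refl , ht′ | refl , hb′ with insertions-only γ j cs ht′ hb′
    ...   | gt≡ , gb≡ , score≡ rewrite gt≡ | gb≡ | score≡ = a-mismatched j
    score-bound (suc i) zero (col (just _) (just _) _ ∷ cs) ht hb with ∷-injective ht | ∷-injective hb
    ... | refl , ht′ | refl , hb′ with deletions-only γ i cs ht′ hb′
    ...   | gt≡ , gb≡ , score≡ rewrite gt≡ | gb≡ | score≡ = b-mismatched i
    score-bound (suc i) j (col (just _) nothing _ ∷ cs) ht hb with ∷-injective ht
    ... | refl , ht′ = bound-after-deletion (score-bound i j cs ht′ hb)
    score-bound zero j (col (just _) nothing _ ∷ cs) ht hb with ∷-injective ht
    ... | refl , ht′ with insertions-only γ j cs ht′ hb
    ...   | gt≡ , gb≡ , score≡ rewrite gt≡ | gb≡ | score≡ = a-deleted j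
    score-bound i (suc j) (col nothing (just _) _ ∷ cs) ht hb with ∷-injective hb
    ... | refl , hb′ = bound-after-insertion (score-bound i j cs ht hb′)
    score-bound i zero (col nothing (just _) _ ∷ cs) ht hb with ∷-injective hb
    ... | refl , hb′ with deletions-only γ i cs ht hb′
    ...   | gt≡ , gb≡ , score≡ rewrite gt≡ | gb≡ | score≡ = b-inserted i

    isDN-padded : ∀ n → A ≤ (u + v) * fromℕ (suc n) → B ≤ (u + v) * fromℕ (suc (suc n)) →
      IsDN γ (replicate n q ++ [ a ]) (replicate n q ++ [ b ]) (min (A * fromℕ (suc n) ⁻¹) (B * fromℕ (suc (suc n)) ⁻¹))
    isDN-padded n A≤ B≤ = isDN-min γ (pad q n (matched a b)) (pad q n (separated a b))
      (trans (normScore-pad γ γqq≡0 n (matched a b))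
             (cong₂ (λ s l → s * fromℕ l ⁻¹) (+-identityʳ A) (ℕ.+-comm n 1)))
      (trans (normScore-pad γ γqq≡0 n (separated a b))
             (cong₂ (λ s l → s * fromℕ l ⁻¹) (cong (γ (just a) gap +_) (+-identityʳ (γ gap (just b)))) (ℕ.+-comm n 2)))
      lower
      where
      lower : ∀ Al → min (A * fromℕ (suc n) ⁻¹) (B * fromℕ (suc (suc n)) ⁻¹) ≤ normScore γ (columns Al)
      lower (alignment cs ht hb) = begin
        min (A * fromℕ (suc n) ⁻¹) (B * fromℕ (suc (suc n)) ⁻¹)
          ≤⟨ ScoreBound⇒min≤ratio n A≤ B≤ (topGaps cs) (score γ cs) bound ⟩
        score γ cs * fromℕ (suc n ℕ.+ topGaps cs) ⁻¹  ≡⟨ cong (λ l → score γ cs * fromℕ l ⁻¹) (sym length≡) ⟩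
        score γ cs * fromℕ (length cs) ⁻¹             ≡⟨ sym (normScore≡score*length⁻¹ γ cs) ⟩
        normScore γ cs                                ∎
        where
        length≡ : length cs ≡ suc n ℕ.+ topGaps cs
        length≡ = trans (length≡top+topGaps cs)
          (cong (ℕ._+ topGaps cs) (trans (cong length ht) (length-replicate-++-[ a ] n)))
        length≡′ : length cs ≡ suc n ℕ.+ bottomGaps cs
        length≡′ = trans (length≡bottom+bottomGaps cs)
          (cong (ℕ._+ bottomGaps cs) (trans (cong length hb) (length-replicate-++-[ b ] n)))
        bound : ScoreBound (topGaps cs) (topGaps cs) (score γ cs)
        bound = subst (λ gb → ScoreBound (topGaps cs) gb (score γ cs))
          (ℕ.+-cancelˡ-≡ (suc n) _ _ (trans (sym length≡′) length≡)) (score-bound n n cs ht hb)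

    eventually-isDN : Positive (u + v) → ∃ λ n₀ → ∀ n → n₀ ℕ.≤ n →
      IsDN γ (replicate n q ++ [ a ]) (replicate n q ++ [ b ]) (min (A * fromℕ (suc n) ⁻¹) (B * fromℕ (suc (suc n)) ⁻¹))
    eventually-isDN u+v>0 with archimedean-multiple u+v>0 A | archimedean-multiple u+v>0 B
    ... | n₁ , A≤ | n₂ , B≤ = n₁ ℕ.⊔ n₂ , λ n n₀≤n →
      isDN-padded n (A≤ (suc n) (ℕ.m≤n⇒m≤1+n (ℕ.m⊔n≤o⇒m≤o n₁ n₂ n₀≤n)))
                    (B≤ (suc (suc n)) (ℕ.m≤n⇒m≤1+n (ℕ.m≤n⇒m≤1+n (ℕ.m⊔n≤o⇒n≤o n₁ n₂ n₀≤n))))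

proposition4 : (𝔽 : OrderedField) (m : ℕ) →
    let open OrderedField 𝔽
        open Alignment 𝔽 m
    in
    (γ : ScoringMatrix) → DNPremetric γ →
    (q : Σ) → (∀ a → gapMax γ a ≤ gapMax γ q) → gapMax γ q ≢ 0# →
    (γ (just q) gap ≡ γ gap (just q)
      ⊎ (∀ a b → (γ (just a) gap ≤ γ (just a) (just q) + γ (just q) gap)
                 × (γ gap (just b) ≤ γ gap (just q) + γ (just q) (just b)))) →
    ∀ a b → ∃ λ (n₀ : ℕ) → ∀ n → n₀ Data.Nat.≤ n →
      IsDN γ (replicate n q ++ [ a ]) (replicate n q ++ [ b ])
        (min (γ (just a) (just b) * (fromℕ (suc n)) ⁻¹)
             ((γ (just a) gap + γ gap (just b)) * (fromℕ (suc (suc n))) ⁻¹))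
proposition4 𝔽 m γ premetric q q-max gapMax≢0 balanced-or-triangles a b =
  eventually-isDN (self-match≡0 q (proj₂ u+v>0)) (proj₁ triangles) (proj₂ triangles) u+v>0
  where
  open OrderedField 𝔽
  open Alignment 𝔽 m
  open OrderedFieldProperties 𝔽
  open PremetricProperties 𝔽 m γ premetric
  u+v>0 : Positive (γ (just q) gap + γ gap (just q))
  u+v>0 = max≢0⇒+-positive (deletion-nonneg q) (insertion-nonneg q) gapMax≢0
  triangles : (γ (just a) gap ≤ γ (just a) (just q) + γ (just q) gap)
            × (γ gap (just b) ≤ γ gap (just q) + γ (just q) (just b))
  triangles = [ balanced-max-gap⇒triangles q q-max , id ]′ balanced-or-triangles a b
  open PaddedWords 𝔽 m γ q a b
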